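{- Let $f:\{0,1\}^n\to\{0,1\}$ be a Boolean function and $0<\epsilon<1$. Then \[ \operatorname{rdeg}_\epsilon(f)\le 2\max\{\mathsf{N}_\epsilon(f),\mathsf{N}_\epsilon(\overline f)\}. \]
   Context: $\mathsf{N}_\epsilon(f)$ is the minimum degree of a real polynomial $p$ with $|p(x)|\le\epsilon$ whenever $f(x)=0$ and $|p(x)|\ge 1$ whenever $f(x)=1$ ($x\in\{0,1\}^n$); $\overline f=1-f$. The approximate rational degree $\operatorname{rdeg}_\epsilon(f)$ is the minimum of $\max\{\deg p,\deg q\}$ over real polynomials $p,q$ with $q(x)\ne 0$ and $|f(x)-p(x)/q(x)|\le\epsilon$ for all $x\in\{0,1\}^n$.
   Formalization: The parameter ε and the coefficients of all polynomials in N_ε and rdeg_ε are rational rather than real. -}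

module Defs where

open import Data.Nat using (ℕ; zero; suc) renaming (_≤_ to _≤ℕ_; _+_ to _+ℕ_)
open import Data.Bool using (Bool; true; false; not)
open import Data.Vec using (Vec) renaming ([] to []ᵛ; _∷_ to _∷ᵛ_)
open import Data.List using (List; []; _∷_)
open import Data.List.Relation.Unary.All using (All)
open import Data.Product using (_×_; _,_; proj₁; proj₂; ∃-syntax)
open import Data.Rational using (ℚ; 0ℚ; 1ℚ; _+_; _*_; _-_; _≤_; ∣_∣)
open import Relation.Binary.PropositionalEquality using (_≡_)
open import Relation.Nullary using (¬_)

Cube : ℕ → Set
Cube n = Vec Bool n

BoolFun : ℕ → Set
BoolFun n = Cube n → Bool

⟦_⟧ : Bool → ℚ
⟦ false ⟧ = 0ℚ
⟦ true  ⟧ = 1ℚ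

compl : ∀ {n} → BoolFun n → BoolFun n
compl f x = not (f x)

Monomial : ℕ → Set
Monomial n = Vec ℕ n

mdeg : ∀ {n} → Monomial n → ℕ
mdeg []ᵛ       = 0
mdeg (e ∷ᵛ es) = e +ℕ mdeg es

_^ℚ_ : ℚ → ℕ → ℚ
q ^ℚ zero  = 1ℚ
q ^ℚ suc k = q * (q ^ℚ k)

mEval : ∀ {n} → Monomial n → Cube n → ℚ
mEval []ᵛ       []ᵛ       = 1ℚ
mEval (e ∷ᵛ es) (b ∷ᵛ bs) = (⟦ b ⟧ ^ℚ e) * mEval es bs

Poly : ℕ → Set
Poly n = List (ℚ × Monomial n)

eval : ∀ {n} → Poly n → Cube n → ℚ
eval []             x = 0ℚ
eval ((c , m) ∷ ts) x = c * mEval m x + eval ts x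

DegLe : ∀ {n} → Poly n → ℕ → Set
DegLe p d = All (λ t → mdeg (proj₂ t) ≤ℕ d) p

NDegLe : ∀ {n} → ℚ → BoolFun n → ℕ → Set
NDegLe {n} ε f d =
  ∃[ p ] (DegLe p d ×
          (∀ (x : Cube n) → f x ≡ false → ∣ eval p x ∣ ≤ ε) ×
          (∀ (x : Cube n) → f x ≡ true  → 1ℚ ≤ ∣ eval p x ∣))

-- rdeg_ε(f) ≤ d : polynomials p, q of degree ≤ d with q(x) ≠ 0 and
--   |f(x) - p(x)/q(x)| ≤ ε for all x, written without division as
--   |f(x) q(x) - p(x)| ≤ ε |q(x)|  (equivalent since q(x) ≠ 0).
RDegLe : ∀ {n} → ℚ → BoolFun n → ℕ → Set
RDegLe {n} ε f d =
  ∃[ p ] ∃[ q ] (DegLe p d × DegLe q d ×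
     (∀ (x : Cube n) → ¬ (eval q x ≡ 0ℚ)) ×
     (∀ (x : Cube n) → ∣ ⟦ f x ⟧ * eval q x - eval p x ∣ ≤ ε * ∣ eval q x ∣))

{-# OPTIONS --safe #-}
-- If p witnesses N_ε(f) and q witnesses N_ε(¬f), then p²/(p² + q²) approximates f.
-- Where f = 1 we have p² ≥ 1 and q² ≤ ε² ≤ ε, so the error q²/(p² + q²) is at most ε;
-- where f = 0 the roles of p and q swap.  The denominator is ≥ 1 everywhere, and
-- squaring only doubles the degree.
module Submission where

open import Data.Bool using (Bool; true; false; not)
open import Data.List using ([]; _∷_; _++_)
open import Data.List.Relation.Unary.All using ([]; _∷_)
open import Data.List.Relation.Unary.All.Properties using (++⁺)
open import Data.Product using (_×_; _,_)
open import Data.Sum using (inj₁; inj₂)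
open import Relation.Binary.PropositionalEquality
  using (_≡_; _≢_; ≢-sym; refl; sym; trans; cong; cong₂; subst; module ≡-Reasoning)

open import Defs

module Squares where

  open import Data.Rational using (ℚ; 0ℚ; 1ℚ; _+_; _*_; _-_; -_; _≤_; ∣_∣; nonNegative; nonPositive)
  open import Data.Rational.Properties
  open import Algebra.Properties.AbelianGroup +-0-abelianGroup using (xyx⁻¹≈y)

  infix 9 _²

  _² : ℚ → ℚ
  p ² = p * p

  private variable
    ε a b p q : ℚ
    v : Bool

  0≤p² : ∀ p → 0ℚ ≤ p ²
  0≤p² p with ≤-total 0ℚ p
  ... | inj₁ 0≤p = nonNegative⁻¹ _ {{nonNeg*nonNeg⇒nonNeg p {{nonNegative 0≤p}} p {{nonNegative 0≤p}}}}
  -- despite its name, the library lemma nonPos*nonPos⇒nonPos concludes NonNegative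
  ... | inj₂ p≤0 = nonNegative⁻¹ _ {{nonPos*nonPos⇒nonPos p {{nonPositive p≤0}} p {{nonPositive p≤0}}}}

  ∣p∣²≡p² : ∀ p → ∣ p ∣ ² ≡ p ²
  ∣p∣²≡p² p = trans (sym (∣p*q∣≡∣p∣*∣q∣ p p)) (0≤p⇒∣p∣≡p (0≤p² p))

  ²-mono-≤ : 0ℚ ≤ p → p ≤ q → p ² ≤ q ²
  ²-mono-≤ {p} {q} 0≤p p≤q =
    ≤-trans (*-monoʳ-≤-nonNeg p {{nonNegative 0≤p}} p≤q)
            (*-monoˡ-≤-nonNeg q {{nonNegative (≤-trans 0≤p p≤q)}} p≤q)

  ∣p∣≤q⇒p²≤q² : ∣ p ∣ ≤ q → p ² ≤ q ²
  ∣p∣≤q⇒p²≤q² {p} ∣p∣≤q = subst (_≤ _) (∣p∣²≡p² p) (²-mono-≤ (0≤∣p∣ p) ∣p∣≤q)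

  1≤∣p∣⇒1≤p² : 1ℚ ≤ ∣ p ∣ → 1ℚ ≤ p ²
  1≤∣p∣⇒1≤p² {p} 1≤∣p∣ = subst (1ℚ ≤_) (∣p∣²≡p² p) (²-mono-≤ (nonNegative⁻¹ 1ℚ) 1≤∣p∣)

  p≤p+q : 0ℚ ≤ q → p ≤ p + q
  p≤p+q {q} {p} 0≤q = subst (_≤ p + q) (+-identityʳ p) (+-monoʳ-≤ p 0≤q)

  0≤a²+b² : ∀ a b → 0ℚ ≤ a ² + b ²
  0≤a²+b² a b = +-mono-≤ (0≤p² a) (0≤p² b)

  1≤∣a∣⇒1≤a²+b² : ∀ b → 1ℚ ≤ ∣ a ∣ → 1ℚ ≤ a ² + b ²
  1≤∣a∣⇒1≤a²+b² b 1≤∣a∣ = ≤-trans (1≤∣p∣⇒1≤p² 1≤∣a∣) (p≤p+q (0≤p² b))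

  b²≤ε*[a²+b²] : ε ≤ 1ℚ → 1ℚ ≤ ∣ a ∣ → ∣ b ∣ ≤ ε → b ² ≤ ε * (a ² + b ²)
  b²≤ε*[a²+b²] {ε} {a} {b} ε≤1 1≤∣a∣ ∣b∣≤ε = begin
    b ²              ≤⟨ ∣p∣≤q⇒p²≤q² {b} ∣b∣≤ε ⟩
    ε * ε            ≤⟨ *-monoˡ-≤-nonNeg ε {{nonNegative 0≤ε}} ε≤a²+b² ⟩
    ε * (a ² + b ²)  ∎
    where
    open ≤-Reasoning
    0≤ε : 0ℚ ≤ ε
    0≤ε = ≤-trans (0≤∣p∣ b) ∣b∣≤ε
    ε≤a²+b² : ε ≤ a ² + b ²
    ε≤a²+b² = ≤-trans ε≤1 (1≤∣a∣⇒1≤a²+b² b 1≤∣a∣)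

  Separates : ℚ → Bool → ℚ → ℚ → Set
  Separates ε true  a b = 1ℚ ≤ ∣ a ∣ × ∣ b ∣ ≤ ε
  Separates ε false a b = ∣ a ∣ ≤ ε × 1ℚ ≤ ∣ b ∣

  separates⇒1≤a²+b² : Separates ε v a b → 1ℚ ≤ a ² + b ²
  separates⇒1≤a²+b² {v = true}  {b = b} (1≤∣a∣ , _) = 1≤∣a∣⇒1≤a²+b² b 1≤∣a∣
  separates⇒1≤a²+b² {v = false} {a} {b} (_ , 1≤∣b∣) =
    subst (1ℚ ≤_) (+-comm (b ²) (a ²)) (1≤∣a∣⇒1≤a²+b² a 1≤∣b∣)

  separates⇒a²+b²≢0 : Separates ε v a b → a ² + b ² ≢ 0ℚ
  separates⇒a²+b²≢0 sep = ≢-sym (<⇒≢ (<-≤-trans (positive⁻¹ 1ℚ) (separates⇒1≤a²+b² sep)))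

  separates⇒a²/[a²+b²]-approx : ε ≤ 1ℚ → Separates ε v a b →
                                ∣ ⟦ v ⟧ * (a ² + b ²) - a ² ∣ ≤ ε * ∣ a ² + b ² ∣
  separates⇒a²/[a²+b²]-approx {ε} {true} {a} {b} ε≤1 (1≤∣a∣ , ∣b∣≤ε) = begin
    ∣ 1ℚ * (a ² + b ²) - a ² ∣  ≡⟨ cong (λ r → ∣ r - a ² ∣) (*-identityˡ (a ² + b ²)) ⟩
    ∣ a ² + b ² - a ² ∣         ≡⟨ cong ∣_∣ (xyx⁻¹≈y (a ²) (b ²)) ⟩
    ∣ b ² ∣                     ≡⟨ 0≤p⇒∣p∣≡p (0≤p² b) ⟩
    b ²                         ≤⟨ b²≤ε*[a²+b²] ε≤1 1≤∣a∣ ∣b∣≤ε ⟩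
    ε * (a ² + b ²)             ≡⟨ cong (ε *_) (0≤p⇒∣p∣≡p (0≤a²+b² a b)) ⟨
    ε * ∣ a ² + b ² ∣           ∎
    where open ≤-Reasoning
  separates⇒a²/[a²+b²]-approx {ε} {false} {a} {b} ε≤1 (∣a∣≤ε , 1≤∣b∣) = begin
    ∣ 0ℚ * (a ² + b ²) - a ² ∣  ≡⟨ cong (λ r → ∣ r - a ² ∣) (*-zeroˡ (a ² + b ²)) ⟩
    ∣ 0ℚ - a ² ∣                ≡⟨ cong ∣_∣ (+-identityˡ (- a ²)) ⟩
    ∣ - a ² ∣                   ≡⟨ ∣-p∣≡∣p∣ (a ²) ⟩
    ∣ a ² ∣                     ≡⟨ 0≤p⇒∣p∣≡p (0≤p² a) ⟩
    a ²                         ≤⟨ b²≤ε*[a²+b²] ε≤1 1≤∣b∣ ∣a∣≤ε ⟩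
    ε * (b ² + a ²)             ≡⟨ cong (ε *_) (+-comm (b ²) (a ²)) ⟩
    ε * (a ² + b ²)             ≡⟨ cong (ε *_) (0≤p⇒∣p∣≡p (0≤a²+b² a b)) ⟨
    ε * ∣ a ² + b ² ∣           ∎
    where open ≤-Reasoning

module Polynomials where

  open import Data.Nat as ℕ using (ℕ; zero; suc)
  import Data.Nat.Properties as ℕ
  open import Data.Vec using () renaming ([] to []ᵛ; _∷_ to _∷ᵛ_)
  open import Data.Rational using (ℚ; 0ℚ; 1ℚ; _+_; _*_; _-_; _≤_; ∣_∣)
  open import Data.Rational.Properties
    using (+-*-commutativeRing; *-identityˡ; *-assoc; *-zeroˡ; *-zeroʳ; *-distribˡ-+; *-distribʳ-+; +-identityˡ; +-assoc)
  open import Algebra.Bundles using (CommutativeRing)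
  open import Algebra.Properties.CommutativeSemigroup (CommutativeRing.*-commutativeSemigroup +-*-commutativeRing)
    using () renaming (interchange to *-interchange)
  open import Algebra.Properties.CommutativeSemigroup ℕ.+-commutativeSemigroup
    using () renaming (interchange to +-interchange)
  open Squares

  private variable
    n d e : ℕ

  _*ᴹ_ : Monomial n → Monomial n → Monomial n
  []ᵛ       *ᴹ []ᵛ       = []ᵛ
  (i ∷ᵛ is) *ᴹ (j ∷ᵛ js) = (i ℕ.+ j) ∷ᵛ (is *ᴹ js)

  ^ℚ-distribˡ-+-* : ∀ r i j → r ^ℚ (i ℕ.+ j) ≡ r ^ℚ i * r ^ℚ j
  ^ℚ-distribˡ-+-* r zero    j = sym (*-identityˡ (r ^ℚ j))
  ^ℚ-distribˡ-+-* r (suc i) j = trans (cong (r *_) (^ℚ-distribˡ-+-* r i j)) (sym (*-assoc r (r ^ℚ i) (r ^ℚ j)))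

  mdeg-*ᴹ : (m m′ : Monomial n) → mdeg (m *ᴹ m′) ≡ mdeg m ℕ.+ mdeg m′
  mdeg-*ᴹ []ᵛ       []ᵛ       = refl
  mdeg-*ᴹ (i ∷ᵛ is) (j ∷ᵛ js) =
    trans (cong ((i ℕ.+ j) ℕ.+_) (mdeg-*ᴹ is js)) (+-interchange i j (mdeg is) (mdeg js))

  mEval-*ᴹ : (m m′ : Monomial n) (x : Cube n) → mEval (m *ᴹ m′) x ≡ mEval m x * mEval m′ x
  mEval-*ᴹ []ᵛ       []ᵛ       []ᵛ       = refl
  mEval-*ᴹ (i ∷ᵛ is) (j ∷ᵛ js) (b ∷ᵛ bs) = begin
    ⟦ b ⟧ ^ℚ (i ℕ.+ j) * mEval (is *ᴹ js) bs              ≡⟨ cong₂ _*_ (^ℚ-distribˡ-+-* ⟦ b ⟧ i j) (mEval-*ᴹ is js bs) ⟩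
    (⟦ b ⟧ ^ℚ i * ⟦ b ⟧ ^ℚ j) * (mEval is bs * mEval js bs) ≡⟨ *-interchange (⟦ b ⟧ ^ℚ i) (⟦ b ⟧ ^ℚ j) (mEval is bs) (mEval js bs) ⟩
    (⟦ b ⟧ ^ℚ i * mEval is bs) * (⟦ b ⟧ ^ℚ j * mEval js bs) ∎
    where open ≡-Reasoning

  _·ᴾ_ : ℚ × Monomial n → Poly n → Poly n
  _       ·ᴾ []              = []
  (c , m) ·ᴾ ((c′ , m′) ∷ q) = (c * c′ , m *ᴹ m′) ∷ ((c , m) ·ᴾ q)

  _*ᴾ_ : Poly n → Poly n → Poly n
  []      *ᴾ q = []
  (t ∷ p) *ᴾ q = t ·ᴾ q ++ p *ᴾ q

  eval-++ : (p q : Poly n) (x : Cube n) → eval (p ++ q) x ≡ eval p x + eval q x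
  eval-++ []            q x = sym (+-identityˡ (eval q x))
  eval-++ ((c , m) ∷ p) q x =
    trans (cong (c * mEval m x +_) (eval-++ p q x)) (sym (+-assoc (c * mEval m x) (eval p x) (eval q x)))

  eval-·ᴾ : ∀ c (m : Monomial n) q x → eval ((c , m) ·ᴾ q) x ≡ c * mEval m x * eval q x
  eval-·ᴾ c m []               x = sym (*-zeroʳ (c * mEval m x))
  eval-·ᴾ c m ((c′ , m′) ∷ q) x = begin
    c * c′ * mEval (m *ᴹ m′) x + eval ((c , m) ·ᴾ q) x
      ≡⟨ cong₂ _+_ (cong (c * c′ *_) (mEval-*ᴹ m m′ x)) (eval-·ᴾ c m q x) ⟩
    c * c′ * (mEval m x * mEval m′ x) + c * mEval m x * eval q x
      ≡⟨ cong (_+ c * mEval m x * eval q x) (*-interchange c c′ (mEval m x) (mEval m′ x)) ⟩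
    c * mEval m x * (c′ * mEval m′ x) + c * mEval m x * eval q x
      ≡⟨ *-distribˡ-+ (c * mEval m x) (c′ * mEval m′ x) (eval q x) ⟨
    c * mEval m x * (c′ * mEval m′ x + eval q x)
      ∎
    where open ≡-Reasoning

  eval-*ᴾ : (p q : Poly n) (x : Cube n) → eval (p *ᴾ q) x ≡ eval p x * eval q x
  eval-*ᴾ []            q x = sym (*-zeroˡ (eval q x))
  eval-*ᴾ ((c , m) ∷ p) q x = begin
    eval ((c , m) ·ᴾ q ++ p *ᴾ q) x                 ≡⟨ eval-++ ((c , m) ·ᴾ q) (p *ᴾ q) x ⟩
    eval ((c , m) ·ᴾ q) x + eval (p *ᴾ q) x         ≡⟨ cong₂ _+_ (eval-·ᴾ c m q x) (eval-*ᴾ p q x) ⟩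
    c * mEval m x * eval q x + eval p x * eval q x  ≡⟨ *-distribʳ-+ (eval q x) (c * mEval m x) (eval p x) ⟨
    (c * mEval m x + eval p x) * eval q x           ∎
    where open ≡-Reasoning

  DegLe-·ᴾ : ∀ {c} {m : Monomial n} {q} → mdeg m ℕ.≤ d → DegLe q e → DegLe ((c , m) ·ᴾ q) (d ℕ.+ e)
  DegLe-·ᴾ         m≤d []            = []
  DegLe-·ᴾ {m = m} m≤d (m′≤e ∷ q≤e) =
    subst (ℕ._≤ _) (sym (mdeg-*ᴹ m _)) (ℕ.+-mono-≤ m≤d m′≤e) ∷ DegLe-·ᴾ m≤d q≤e

  DegLe-*ᴾ : {p q : Poly n} → DegLe p d → DegLe q e → DegLe (p *ᴾ q) (d ℕ.+ e)
  DegLe-*ᴾ []          q≤e = []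
  DegLe-*ᴾ (m≤d ∷ p≤d) q≤e = ++⁺ (DegLe-·ᴾ m≤d q≤e) (DegLe-*ᴾ p≤d q≤e)

  DegLe-square : {p : Poly n} → DegLe p d → DegLe (p *ᴾ p) (2 ℕ.* d)
  DegLe-square {d = d} p≤d = subst (DegLe _) (cong (d ℕ.+_) (sym (ℕ.+-identityʳ d))) (DegLe-*ᴾ p≤d p≤d)

  module _ (p q : Poly n) (x : Cube n) where

    eval-p²+q² : eval (p *ᴾ p ++ q *ᴾ q) x ≡ eval p x ² + eval q x ²
    eval-p²+q² = trans (eval-++ (p *ᴾ p) (q *ᴾ q) x) (cong₂ _+_ (eval-*ᴾ p p x) (eval-*ᴾ q q x))

    separates⇒p²+q²≢0 : ∀ {ε v} → Separates ε v (eval p x) (eval q x) → eval (p *ᴾ p ++ q *ᴾ q) x ≢ 0ℚ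
    separates⇒p²+q²≢0 sep = subst (_≢ 0ℚ) (sym eval-p²+q²) (separates⇒a²+b²≢0 sep)

    separates⇒p²/[p²+q²]-approx : ∀ {ε v} → ε ≤ 1ℚ → Separates ε v (eval p x) (eval q x) →
      ∣ ⟦ v ⟧ * eval (p *ᴾ p ++ q *ᴾ q) x - eval (p *ᴾ p) x ∣ ≤ ε * ∣ eval (p *ᴾ p ++ q *ᴾ q) x ∣
    separates⇒p²/[p²+q²]-approx ε≤1 sep
      rewrite eval-p²+q² | eval-*ᴾ p p x = separates⇒a²/[a²+b²]-approx ε≤1 sep

open Squares using (Separates)
open Polynomials using (_*ᴾ_; DegLe-square; separates⇒p²+q²≢0; separates⇒p²/[p²+q²]-approx)

-- The rational operators stay local to the modules above, so that _*_ below is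
-- multiplication on ℕ, as in the statement.
open import Data.Nat using (ℕ; _*_)
open import Data.Rational using (ℚ; 0ℚ; 1ℚ; _<_)
open import Data.Rational.Properties using (<⇒≤)

lemma5 : (n : ℕ) (f : BoolFun n) (ε : ℚ) → 0ℚ < ε → ε < 1ℚ →
    (d : ℕ) → NDegLe ε f d → NDegLe ε (compl f) d → RDegLe ε f (2 * d)
lemma5 n f ε _ ε<1 d (p , p-deg , p-small , p-large) (q , q-deg , q-small , q-large) =
  p *ᴾ p , p *ᴾ p ++ q *ᴾ q ,
  DegLe-square p-deg , ++⁺ (DegLe-square p-deg) (DegLe-square q-deg) ,
  (λ x → separates⇒p²+q²≢0 p q x (separates x)) ,
  (λ x → separates⇒p²/[p²+q²]-approx p q x (<⇒≤ ε<1) (separates x))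
  where
  separates : ∀ x → Separates ε (f x) (eval p x) (eval q x)
  separates x with f x in fx
  ... | true  = p-large x fx , q-small x (cong not fx)
  ... | false = p-small x fx , q-large x (cong not fx)
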